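{- In any partial graph with a local coloring, the relation $\lhd$ is a strict partial order (irreflexive and transitive) on vertex-color pairs.
   Context: A partial graph is a triple $(\mathcal V,\mathcal E,\psi)$ of disjoint finite sets of vertices and edges and a function $\psi$ giving each edge a set of at most two endpoints. A path is an alternating sequence $(v_0,e_1,v_1,\dots,e_n,v_n)$ with the endpoints of $e_i$ exactly $v_{i-1}\neq v_i$; simple if edges are pairwise distinct and vertices pairwise distinct except possibly $v_0=v_n$; open if $v_0\neq v_n$. A local coloring $\mathsf c$ assigns a color (from a finite set $\mathsf C$) to each pair $(e,w)$ with $w$ an endpoint of $e$; a vertex-color pair is an element of $\mathcal V\times\mathsf C$. A cusp is a triple $(e,w,f)$ of distinct edges incident to $w$ with $\mathsf c(e,w)=\mathsf c(f,w)$; a path is cusp-free if no consecutive $(e_i,v_i,e_{i+1})$ is a cusp (and, if closed, $(e_n,v_0,e_1)$ is not a cusp). Starting color: $\mathsf c(e_1,v_0)$; ending color: $\mathsf c(e_n,v_n)$. Write $(v,\alpha)\to_p(u,\beta)$ if $p$ is a simple open cusp-free path from $v$ to $u$ with starting color not $\alpha$ and ending color $\beta$. Write $(v,\alpha)\lhd(u,\beta)$ if there exists $p$ with $(v,\alpha)\to_p(u,\beta)$ such that for every vertex $x$, color $\tau$ and path $q$ with $(u,\beta)\to_q(x,\tau)$, $x$ does not occur in $p$. -}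

module Defs where

open import Data.Nat using (ℕ; zero; suc; _≤_)
open import Data.Fin using (Fin; zero; suc; inject₁; fromℕ)
open import Data.Fin.Subset using (Subset; ⁅_⁆; _∪_; _∈_; ∣_∣)
open import Data.Product using (Σ; ∃; _×_; _,_)
open import Data.Sum using (_⊎_)
open import Relation.Binary.PropositionalEquality using (_≡_; _≢_)
open import Relation.Nullary using (¬_)

record PartialGraph (n m : ℕ) : Set where
  field
    ψ     : Fin m → Subset n
    ψ-≤2  : ∀ e → ∣ ψ e ∣ ≤ 2
open PartialGraph public

module _ {n m : ℕ} (G : PartialGraph n m) where

  Joins : Fin m → Fin n → Fin n → Set
  Joins e v u = v ≢ u × ψ G e ≡ ⁅ v ⁆ ∪ ⁅ u ⁆

  -- A path (v₀,e₁,v₁,…,e_ℓ,v_ℓ) of length ℓ: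
  -- vertex v_i is vtx i (i = 0..ℓ), edge e_{i+1} is edg i (i = 0..ℓ-1).
  record Path (ℓ : ℕ) : Set where
    field
      vtx   : Fin (suc ℓ) → Fin n
      edg   : Fin ℓ → Fin m
      joins : ∀ i → Joins (edg i) (vtx (inject₁ i)) (vtx (suc i))
  open Path public

  first : ∀ {ℓ} → Path ℓ → Fin n
  first p = vtx p zero

  last : ∀ {ℓ} → Path ℓ → Fin n
  last {ℓ} p = vtx p (fromℕ ℓ)

  Simple : ∀ {ℓ} → Path ℓ → Set
  Simple {ℓ} p =
    (∀ i j → edg p i ≡ edg p j → i ≡ j) ×
    (∀ i j → vtx p i ≡ vtx p j →
       i ≡ j ⊎ ((i ≡ zero × j ≡ fromℕ ℓ) ⊎ (i ≡ fromℕ ℓ × j ≡ zero)))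

  Open : ∀ {ℓ} → Path ℓ → Set
  Open p = first p ≢ last p

  -- local colorings with colours in Fin k; only the values c e w with
  -- w an endpoint of e are ever used
  Coloring : ℕ → Set
  Coloring k = Fin m → Fin n → Fin k

  module _ {k : ℕ} (c : Coloring k) where

    Cusp : Fin m → Fin n → Fin m → Set
    Cusp e w f = e ≢ f × w ∈ ψ G e × w ∈ ψ G f × c e w ≡ c f w

    CuspFree : ∀ {ℓ} → Path (suc ℓ) → Set
    CuspFree {ℓ} p =
      (∀ (j : Fin ℓ) → ¬ Cusp (edg p (inject₁ j)) (vtx p (suc (inject₁ j))) (edg p (suc j))) ×
      (first p ≡ last p → ¬ Cusp (edg p (fromℕ ℓ)) (first p) (edg p zero))

    startColor : ∀ {ℓ} → Path (suc ℓ) → Fin k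
    startColor p = c (edg p zero) (first p)

    endColor : ∀ {ℓ} → Path (suc ℓ) → Fin k
    endColor {ℓ} p = c (edg p (fromℕ ℓ)) (last p)

    -- (v , α) →ₚ (u , β)
    -- (an open path has at least one edge, hence the index suc ℓ)
    Arrow : Fin n × Fin k → ∀ {ℓ} → Path (suc ℓ) → Fin n × Fin k → Set
    Arrow (v , α) p (u , β) =
      Simple p × Open p × CuspFree p ×
      first p ≡ v × last p ≡ u ×
      startColor p ≢ α × endColor p ≡ β

    Occurs : Fin n → ∀ {ℓ} → Path ℓ → Set
    Occurs x p = ∃ λ i → vtx p i ≡ x

    _⊲_ : Fin n × Fin k → Fin n × Fin k → Set
    vα ⊲ uβ =
      Σ ℕ λ ℓ → Σ (Path (suc ℓ)) λ p →
        Arrow vα p uβ ×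
        (∀ (x : Fin n) (τ : Fin k) (ℓ' : ℕ) (q : Path (suc ℓ')) →
           Arrow uβ q (x , τ) → ¬ Occurs x p)

-- Irreflexivity holds because an arrow is an open path, so it cannot return to
-- its starting vertex. For transitivity let p witness (v,α) ⊲ (u,β) and q witness
-- (u,β) ⊲ (w,γ). Every prefix of q is an arrow out of (u,β), so no vertex of q
-- after u lies on p; hence p·q is simple (a shared edge would put an endpoint of
-- q on p), and it has no cusp at u because q starts with a colour other than β,
-- the colour with which p ends. Finally, if an arrow r out of (w,γ) ended on p·q,
-- then either it ends on q, contradicting q's property, or it ends on p, and then
-- q·r is an arrow out of (u,β) ending on p, contradicting p's property.
module Submission where

open import Defs
open import Data.Nat using (ℕ; zero; suc; _+_; _≤_; _<_; z≤n; s≤s; z<s)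
open import Data.Nat.Properties using (0≢1+n; ≤-refl; n≤1+n; ≤-pred; <⇒≤; <-irrefl; <-≤-trans; m≤n⇒m≤1+n; m≤n⇒m<n∨m≡n; +-suc; +-identityʳ; +-cancelˡ-≤; +-cancelˡ-<)
open import Data.Fin using (Fin; zero; suc; toℕ; inject₁; fromℕ)
open import Data.Fin.Properties using (toℕ-injective; toℕ<n; toℕ≤pred[n]; toℕ-fromℕ; toℕ-inject₁)
open import Data.Fin.Subset using (_∈_)
open import Data.Fin.Subset.Properties using (x∈⁅x⁆; x∈⁅y⁆⇒x≡y; x∈p∪q⁻; x∈p∪q⁺)
open import Data.Product using (_×_; Σ-syntax; _,_; proj₁; proj₂)
open import Data.Sum using (_⊎_; inj₁; inj₂; [_,_]′)
open import Data.Empty using (⊥-elim)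
open import Function using (_∘_)
open import Relation.Nullary using (¬_)
open import Relation.Binary.Definitions using (Irreflexive; Transitive)
open import Relation.Binary.PropositionalEquality using (_≡_; _≢_; refl; sym; trans; cong; cong₂; subst; module ≡-Reasoning)

subst₃ : ∀ {A B C : Set} (P : A → B → C → Set) {a a' b b' c c'} →
         a ≡ a' → b ≡ b' → c ≡ c' → P a b c → P a' b' c'
subst₃ P refl refl refl p = p

-- i as an element of Fin (suc L), saturating at L when i > L.
clamp : (L : ℕ) → ℕ → Fin (suc L)
clamp L       zero    = zero
clamp zero    (suc i) = zero
clamp (suc L) (suc i) = suc (clamp L i)

toℕ-clamp : ∀ L {i} → i ≤ L → toℕ (clamp L i) ≡ i
toℕ-clamp L       {zero}  _         = refl
toℕ-clamp (suc L) {suc i} (s≤s i≤L) = cong suc (toℕ-clamp L i≤L)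

clamp-injective : ∀ L {i j} → i ≤ L → j ≤ L → clamp L i ≡ clamp L j → i ≡ j
clamp-injective L i≤L j≤L eq =
  trans (sym (toℕ-clamp L i≤L)) (trans (cong toℕ eq) (toℕ-clamp L j≤L))

inject₁-clamp : ∀ L {i} → i ≤ L → inject₁ (clamp L i) ≡ clamp (suc L) i
inject₁-clamp L       {zero}  _         = refl
inject₁-clamp (suc L) {suc i} (s≤s i≤L) = cong suc (inject₁-clamp L i≤L)

clamp-self : ∀ L → clamp L L ≡ fromℕ L
clamp-self zero    = refl
clamp-self (suc L) = cong suc (clamp-self L)

module _ {A : Set} where

  InjectiveBelow : ℕ → (ℕ → A) → Set
  InjectiveBelow L f = ∀ i j → i < L → j < L → f i ≡ f j → i ≡ j

  InjectiveBelow-mono : ∀ {L L'} {f : ℕ → A} → L' ≤ L → InjectiveBelow L f → InjectiveBelow L' f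
  InjectiveBelow-mono L'≤L f-inj i j i< j< = f-inj i j (<-≤-trans i< L'≤L) (<-≤-trans j< L'≤L)

  glue : ℕ → (ℕ → A) → (ℕ → A) → ℕ → A
  glue zero    f g i       = g i
  glue (suc L) f g zero    = f zero
  glue (suc L) f g (suc i) = glue L (f ∘ suc) g i

  glue-< : ∀ L (f g : ℕ → A) {i} → i < L → glue L f g i ≡ f i
  glue-< (suc L) f g {zero}  _         = refl
  glue-< (suc L) f g {suc i} (s≤s i<L) = glue-< L (f ∘ suc) g i<L

  glue-≤ : ∀ L (f g : ℕ → A) {i} → f L ≡ g 0 → i ≤ L → glue L f g i ≡ f i
  glue-≤ zero    f g link z≤n       = sym link
  glue-≤ (suc L) f g link z≤n       = refl
  glue-≤ (suc L) f g link (s≤s i≤L) = glue-≤ L (f ∘ suc) g link i≤L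

  glue-+ : ∀ L (f g : ℕ → A) j → glue L f g (L + j) ≡ g j
  glue-+ zero    f g j = refl
  glue-+ (suc L) f g j = glue-+ L (f ∘ suc) g j

  glue-suc-+ : ∀ L (f g : ℕ → A) j → glue L f g (suc (L + j)) ≡ g (suc j)
  glue-suc-+ L f g j = trans (cong (glue L f g) (sym (+-suc L j))) (glue-+ L f g (suc j))

data GlueView (L : ℕ) : ℕ → Set where
  left  : ∀ {i} → i < L → GlueView L i
  right : ∀ j → GlueView L (L + j)

glueView : ∀ L i → GlueView L i
glueView zero    i       = right i
glueView (suc L) zero    = left z<s
glueView (suc L) (suc i) with glueView L i
... | left i<L = left (s≤s i<L)
... | right j  = right j

glue-injective : ∀ {A : Set} L {M} {f g : ℕ → A} →
                 InjectiveBelow L f → InjectiveBelow M g →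
                 (∀ i j → i < L → j < M → f i ≢ g j) →
                 InjectiveBelow (L + M) (glue L f g)
glue-injective L {M} {f} {g} f-inj g-inj f≢g i j i< j< eq with glueView L i | glueView L j
... | left i<L | left j<L =
  f-inj i j i<L j<L (trans (sym (glue-< L f g i<L)) (trans eq (glue-< L f g j<L)))
... | left i<L | right j' =
  ⊥-elim (f≢g i j' i<L (+-cancelˡ-< L j' M j<) (trans (sym (glue-< L f g i<L)) (trans eq (glue-+ L f g j'))))
... | right i' | left j<L =
  ⊥-elim (f≢g j i' j<L (+-cancelˡ-< L i' M i<) (trans (sym (glue-< L f g j<L)) (trans (sym eq) (glue-+ L f g i'))))
... | right i' | right j' =
  cong (L +_) (g-inj i' j' (+-cancelˡ-< L i' M i<) (+-cancelˡ-< L j' M j<)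
                     (trans (sym (glue-+ L f g i')) (trans eq (glue-+ L f g j'))))

module _ {n m : ℕ} (G : PartialGraph n m) where

  Joins-target : ∀ {e x y} → Joins G e x y → y ∈ ψ G e
  Joins-target {y = y} (_ , ψe≡) = subst (y ∈_) (sym ψe≡) (x∈p∪q⁺ (inj₂ (x∈⁅x⁆ y)))

  Joins-endpoint : ∀ {e x y z} → Joins G e x y → z ∈ ψ G e → z ≡ x ⊎ z ≡ y
  Joins-endpoint {x = x} {y} {z} (_ , ψe≡) z∈ψe with x∈p∪q⁻ _ _ (subst (z ∈_) ψe≡ z∈ψe)
  ... | inj₁ z∈x = inj₁ (x∈⁅y⁆⇒x≡y x z∈x)
  ... | inj₂ z∈y = inj₂ (x∈⁅y⁆⇒x≡y y z∈y)

  module _ {k : ℕ} (c : Coloring G k) where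

    -- An arrow as ℕ-indexed sequences, which makes concatenation easy: vertices
    -- vert 0 … vert (suc ℓ), edges edge 0 … edge ℓ. Injectivity of vert on that
    -- range expresses simplicity and openness at once.
    record Arrowℕ (vα uβ : Fin n × Fin k) : Set where
      field
        ℓ           : ℕ
        vert        : ℕ → Fin n
        edge        : ℕ → Fin m
        step        : ∀ i → i < suc ℓ → Joins G (edge i) (vert i) (vert (suc i))
        edge-inj    : InjectiveBelow (suc ℓ) edge
        vert-inj    : InjectiveBelow (suc (suc ℓ)) vert
        cusp-free   : ∀ j → j < ℓ → ¬ Cusp G c (edge j) (vert (suc j)) (edge (suc j))
        vert-first  : vert 0 ≡ proj₁ vα
        vert-last   : vert (suc ℓ) ≡ proj₁ uβ
        start-color : c (edge 0) (vert 0) ≢ proj₂ vα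
        end-color   : c (edge ℓ) (vert (suc ℓ)) ≡ proj₂ uβ
    open Arrowℕ

    Visits : ∀ {vα uβ} → Arrowℕ vα uβ → Fin n → Set
    Visits a x = Σ[ i ∈ ℕ ] i ≤ suc (ℓ a) × vert a i ≡ x

    Avoids : ∀ {vα uβ} → Arrowℕ vα uβ → Fin n × Fin k → Set
    Avoids a uβ = ∀ {xτ} → Arrowℕ uβ xτ → ¬ Visits a (proj₁ xτ)

    _⊲ℕ_ : Fin n × Fin k → Fin n × Fin k → Set
    vα ⊲ℕ uβ = Σ[ a ∈ Arrowℕ vα uβ ] Avoids a uβ

    prefix : ∀ {vα uβ} (a : Arrowℕ vα uβ) j → j ≤ ℓ a →
             Arrowℕ vα (vert a (suc j) , c (edge a j) (vert a (suc j)))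
    prefix a j j≤ℓ = record
      { ℓ           = j
      ; vert        = vert a
      ; edge        = edge a
      ; step        = λ i i< → step a i (<-≤-trans i< (s≤s j≤ℓ))
      ; edge-inj    = InjectiveBelow-mono (s≤s j≤ℓ) (edge-inj a)
      ; vert-inj    = InjectiveBelow-mono (s≤s (s≤s j≤ℓ)) (vert-inj a)
      ; cusp-free   = λ i i< → cusp-free a i (<-≤-trans i< j≤ℓ)
      ; vert-first  = vert-first a
      ; vert-last   = refl
      ; start-color = start-color a
      ; end-color   = refl
      }

    TailDisjoint : ∀ {vα uβ wγ} → Arrowℕ vα uβ → Arrowℕ uβ wγ → Set
    TailDisjoint a b = ∀ j → j < suc (ℓ b) → ¬ Visits a (vert b (suc j))

    avoids⇒tail-disjoint : ∀ {vα uβ wγ} (a : Arrowℕ vα uβ) →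
                           Avoids a uβ → (b : Arrowℕ uβ wγ) → TailDisjoint a b
    avoids⇒tail-disjoint _ avoids b j j< = avoids (prefix b j (≤-pred j<))

    module Append {vα uβ wγ} (a : Arrowℕ vα uβ) (b : Arrowℕ uβ wγ) (disjoint : TailDisjoint a b) where

      private
        la = ℓ a
        lb = ℓ b

        V : ℕ → Fin n
        V = glue (suc la) (vert a) (vert b)

        E : ℕ → Fin m
        E = glue (suc la) (edge a) (edge b)

        V-left : ∀ {i} → i ≤ suc la → V i ≡ vert a i
        V-left = glue-≤ (suc la) (vert a) (vert b) (trans (vert-last a) (sym (vert-first b)))

        V-right : ∀ j → V (suc la + j) ≡ vert b j
        V-right = glue-+ (suc la) (vert a) (vert b)

        V-right-suc : ∀ j → V (suc (suc la + j)) ≡ vert b (suc j)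
        V-right-suc = glue-suc-+ (suc la) (vert a) (vert b)

        E-left : ∀ {i} → i < suc la → E i ≡ edge a i
        E-left = glue-< (suc la) (edge a) (edge b)

        E-right : ∀ j → E (suc la + j) ≡ edge b j
        E-right = glue-+ (suc la) (edge a) (edge b)

        E-right-suc : ∀ j → E (suc (suc la + j)) ≡ edge b (suc j)
        E-right-suc = glue-suc-+ (suc la) (edge a) (edge b)

        vert-≢ : ∀ i j → i < suc la → j < suc (suc lb) → vert a i ≢ vert b j
        vert-≢ i zero i< _ eq =
          <-irrefl (vert-inj a i (suc la) (m≤n⇒m≤1+n i<) ≤-refl
                     (trans eq (trans (vert-first b) (sym (vert-last a))))) i<
        vert-≢ i (suc j) i< j< eq = disjoint j (≤-pred j<) (i , <⇒≤ i< , eq)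

        edge-≢ : ∀ i j → i < suc la → j < suc lb → edge a i ≢ edge b j
        edge-≢ i j i< j< eq
          with Joins-endpoint (step a i i<)
                 (subst (λ e → vert b (suc j) ∈ ψ G e) (sym eq) (Joins-target (step b j j<)))
        ... | inj₁ at-i   = disjoint j j< (i , <⇒≤ i< , sym at-i)
        ... | inj₂ at-suc = disjoint j j< (suc i , i< , sym at-suc)

        no-cusp-at-junction : ¬ Cusp G c (E la) (V (suc la)) (E (suc la))
        no-cusp-at-junction (_ , _ , _ , same-color) = start-color b (begin
          c (edge b 0) (vert b 0)          ≡⟨ cong₂ c (sym E-junction) (sym (V-right 0)) ⟩
          c (E (suc la)) (V (suc la + 0))  ≡⟨ cong (c (E (suc la)) ∘ V) (+-identityʳ (suc la)) ⟩
          c (E (suc la)) (V (suc la))      ≡⟨ sym same-color ⟩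
          c (E la) (V (suc la))            ≡⟨ cong₂ c (E-left ≤-refl) (V-left ≤-refl) ⟩
          c (edge a la) (vert a (suc la))  ≡⟨ end-color a ⟩
          proj₂ uβ                         ∎)
          where
            open ≡-Reasoning
            E-junction : E (suc la) ≡ edge b 0
            E-junction = trans (cong E (sym (+-identityʳ (suc la)))) (E-right 0)

      append : Arrowℕ vα wγ
      ℓ append = la + suc lb
      vert append = V
      edge append = E
      step append i i< with glueView (suc la) i
      ... | left i<la = subst₃ (Joins G) (sym (E-left i<la)) (sym (V-left (<⇒≤ i<la))) (sym (V-left i<la))
                                (step a i i<la)
      ... | right j   = subst₃ (Joins G) (sym (E-right j)) (sym (V-right j)) (sym (V-right-suc j))
                                (step b j (+-cancelˡ-< (suc la) j (suc lb) i<))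
      edge-inj append = glue-injective (suc la) (edge-inj a) (edge-inj b) edge-≢
      vert-inj append =
        subst (λ L → InjectiveBelow L V) (cong suc (+-suc la (suc lb)))
          (glue-injective (suc la) (InjectiveBelow-mono (n≤1+n (suc la)) (vert-inj a)) (vert-inj b) vert-≢)
      cusp-free append j j< cusp with glueView (suc la) j
      ... | right j' =
        cusp-free b j' j'<lb (subst₃ (Cusp G c) (E-right j') (V-right-suc j') (E-right-suc j') cusp)
        where
          j'<lb : j' < lb
          j'<lb = ≤-pred (+-cancelˡ-< la (suc j') (suc lb) (subst (_< la + suc lb) (sym (+-suc la j')) j<))
      ... | left j<sla with m≤n⇒m<n∨m≡n (≤-pred j<sla)
      ...   | inj₁ j<la =
        cusp-free a j j<la (subst₃ (Cusp G c) (E-left j<sla) (V-left j<sla) (E-left (s≤s j<la)) cusp)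
      ...   | inj₂ refl = no-cusp-at-junction cusp
      vert-first append = trans (V-left z≤n) (vert-first a)
      vert-last append = trans (V-right (suc lb)) (vert-last b)
      start-color append = start-color a
      end-color append = trans (cong₂ c E-last (V-right (suc lb))) (end-color b)
        where
          E-last : E (la + suc lb) ≡ edge b lb
          E-last = trans (cong E (+-suc la lb)) (E-right lb)

      visits-append : ∀ {x} → Visits append x → Visits a x ⊎ Visits b x
      visits-append (i , i≤ , eq) with glueView (suc la) i
      ... | left i<la = inj₁ (i , <⇒≤ i<la , trans (sym (V-left (<⇒≤ i<la))) eq)
      ... | right j   = inj₂ (j , +-cancelˡ-≤ la j (suc lb) (≤-pred i≤) , trans (sym (V-right j)) eq)

    ⊲ℕ-trans : Transitive _⊲ℕ_
    ⊲ℕ-trans (a , a-avoids) (b , b-avoids) =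
      Append.append a b a⌢b , λ r →
        [ a-avoids (Append.append b r (avoids⇒tail-disjoint b b-avoids r)) , b-avoids r ]′
        ∘ Append.visits-append a b a⌢b
      where
        a⌢b : TailDisjoint a b
        a⌢b = avoids⇒tail-disjoint a a-avoids b

    toPath : ∀ {vα uβ} (a : Arrowℕ vα uβ) → Path G (suc (ℓ a))
    vtx (toPath a) i = vert a (toℕ i)
    edg (toPath a) i = edge a (toℕ i)
    joins (toPath a) i =
      subst₃ (Joins G) refl (cong (vert a) (sym (toℕ-inject₁ i))) refl (step a (toℕ i) (toℕ<n i))

    toPath-arrow : ∀ {vα uβ} (a : Arrowℕ vα uβ) → Arrow G c vα (toPath a) uβ
    toPath-arrow a =
      ( (λ i j eq → toℕ-injective (edge-inj a _ _ (toℕ<n i) (toℕ<n j) eq))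
      , (λ i j eq → inj₁ (toℕ-injective (vert-inj a _ _ (toℕ<n i) (toℕ<n j) eq))) )
      , open-path
      , (no-inner-cusp , λ closed _ → open-path closed)
      , vert-first a
      , trans (cong (vert a) (toℕ-fromℕ _)) (vert-last a)
      , start-color a
      , trans (cong₂ c (cong (edge a) (toℕ-fromℕ _)) (cong (vert a) (toℕ-fromℕ _))) (end-color a)
      where
        open-path : Open G (toPath a)
        open-path eq = 0≢1+n (vert-inj a 0 _ z<s (toℕ<n (fromℕ (suc (ℓ a)))) eq)

        no-inner-cusp : ∀ (j : Fin (ℓ a)) →
          ¬ Cusp G c (edge a (toℕ (inject₁ j))) (vert a (suc (toℕ (inject₁ j)))) (edge a (suc (toℕ j)))
        no-inner-cusp j cusp =
          cusp-free a (toℕ j) (toℕ<n j)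
            (subst₃ (Cusp G c) (cong (edge a) (toℕ-inject₁ j)) (cong (vert a ∘ suc) (toℕ-inject₁ j)) refl cusp)

    CuspFree-clamped : ∀ {l} (p : Path G (suc l)) → CuspFree G c p → ∀ j → j < l →
      ¬ Cusp G c (edg p (clamp l j)) (vtx p (clamp (suc l) (suc j))) (edg p (clamp l (suc j)))
    CuspFree-clamped {suc l} p (no-inner-cusp , _) j j< cusp =
      no-inner-cusp (clamp l j) (subst₃ (Cusp G c) (cong (edg p) inj≡) (cong (vtx p ∘ suc) inj≡) refl cusp)
      where
        inj≡ : clamp (suc l) j ≡ inject₁ (clamp l j)
        inj≡ = sym (inject₁-clamp l (≤-pred j<))

    fromPath : ∀ {vα uβ l} (p : Path G (suc l)) → Arrow G c vα p uβ → Arrowℕ vα uβ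
    fromPath {l = l} p ((edges-distinct , vertices-distinct) , open-path , no-cusp , first≡ , last≡ , start≢ , end≡) =
      record
        { ℓ           = l
        ; vert        = vtx p ∘ clamp (suc l)
        ; edge        = edg p ∘ clamp l
        ; step        = λ i i< →
            subst₃ (Joins G) refl (cong (vtx p) (inject₁-clamp l (≤-pred i<))) refl (joins p (clamp l i))
        ; edge-inj    = λ i j i< j< eq → clamp-injective l (≤-pred i<) (≤-pred j<) (edges-distinct _ _ eq)
        ; vert-inj    = vertices-injective
        ; cusp-free   = CuspFree-clamped p no-cusp
        ; vert-first  = first≡
        ; vert-last   = trans (cong (vtx p) (clamp-self (suc l))) last≡
        ; start-color = start≢
        ; end-color   = trans (cong₂ c (cong (edg p) (clamp-self l)) (cong (vtx p) (clamp-self (suc l)))) end≡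
        }
      where
        vertices-injective : InjectiveBelow (suc (suc l)) (vtx p ∘ clamp (suc l))
        vertices-injective i j i< j< eq with vertices-distinct _ _ eq
        ... | inj₁ same = clamp-injective (suc l) (≤-pred i<) (≤-pred j<) same
        ... | inj₂ (inj₁ (i≡0 , j≡last)) =
          ⊥-elim (open-path (trans (cong (vtx p) (sym i≡0)) (trans eq (cong (vtx p) j≡last))))
        ... | inj₂ (inj₂ (i≡last , j≡0)) =
          ⊥-elim (open-path (trans (cong (vtx p) (sym j≡0)) (trans (sym eq) (cong (vtx p) i≡last))))

    ⊲⇒⊲ℕ : ∀ {vα uβ} → _⊲_ G c vα uβ → vα ⊲ℕ uβ
    ⊲⇒⊲ℕ (l , p , arrow , avoids) =
      fromPath p arrow , λ r (i , _ , eq) → avoids _ _ _ (toPath r) (toPath-arrow r) (clamp (suc l) i , eq)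

    ⊲ℕ⇒⊲ : ∀ {vα uβ} → vα ⊲ℕ uβ → _⊲_ G c vα uβ
    ⊲ℕ⇒⊲ (a , avoids) =
      ℓ a , toPath a , toPath-arrow a ,
      λ _ _ _ q arrow (i , eq) → avoids (fromPath q arrow) (toℕ i , toℕ≤pred[n] i , eq)

    ⊲-irrefl : Irreflexive _≡_ (_⊲_ G c)
    ⊲-irrefl refl (_ , _ , (_ , open-path , _ , first≡ , last≡ , _) , _) =
      open-path (trans first≡ (sym last≡))

    ⊲-trans : Transitive (_⊲_ G c)
    ⊲-trans p q = ⊲ℕ⇒⊲ (⊲ℕ-trans (⊲⇒⊲ℕ p) (⊲⇒⊲ℕ q))

lemma3p4 : ∀ {n m k : ℕ} (G : PartialGraph n m) (c : Coloring G k) →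
    Irreflexive _≡_ (_⊲_ G c) × Transitive (_⊲_ G c)
lemma3p4 G c = ⊲-irrefl G c , ⊲-trans G c
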